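{- Let $n\ge 2$ and let $a_i(t)=\alpha_it+\beta_i$ for $1\le i\le n$, where for each $i$ either $\alpha_i\in\mathbb{Z}_+$ and $\beta_i\in\mathbb{Z}$, or $\alpha_i=0$ and $\beta_i\in\mathbb{Z}_+$. Suppose $\beta_i\alpha_j\le\beta_j\alpha_i$ whenever $i\le j$, and $\beta_1\alpha_n<\beta_n\alpha_1$. Then there exists a finite set $H$ of integer-valued polynomials in $t$ of degree at most $1$ such that, for every $t\in\mathbb{Z}_+$ with $a_i(t)>0$ for all $i$, $$\langle a_1(t),\ldots,a_n(t)\rangle=\bigcup_{h\in H}\Big(h(t)+\langle a_1(t),a_n(t)\rangle\Big).$$ Furthermore, $0\in H$ and every other $h\in H$ is eventually positive (i.e. $h(t)>0$ for all sufficiently large $t$).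
   Context: For positive integers $a_1,\ldots,a_k$, $\langle a_1,\ldots,a_k\rangle=\{\sum_{i=1}^k p_ia_i : p_i\in\mathbb{Z}_{\ge 0}\}$ denotes the semigroup they generate, and $x+A=\{x+a: a\in A\}$. -}

module Defs where

open import Data.Nat using (ℕ; zero; suc)
open import Data.Integer using (ℤ; +_; _+_; _*_; _<_; _≤_)
open import Data.Fin using (Fin; zero; suc)
open import Data.Product using (Σ; ∃; _×_; _,_)
open import Relation.Binary.PropositionalEquality using (_≡_)

sumFin : (n : ℕ) → (Fin n → ℤ) → ℤ
sumFin zero    f = + 0
sumFin (suc n) f = f zero + sumFin n (λ i → f (suc i))

InSG : (n : ℕ) → (Fin n → ℤ) → ℤ → Set
InSG n a x = Σ (Fin n → ℕ) λ p → x ≡ sumFin n (λ i → (+ p i) * a i)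

InShift : ℤ → (n : ℕ) → (Fin n → ℤ) → ℤ → Set
InShift c n a x = Σ ℤ λ y → InSG n a y × x ≡ c + y

-- A polynomial of degree ≤ 1 with integer values, c·t + d, represented by (c , d).
-- (An integer-valued polynomial of degree ≤ 1 has integer coefficients.)
Poly1 : Set
Poly1 = ℤ × ℤ

evalP : Poly1 → ℕ → ℤ
evalP (c , d) t = c * (+ t) + d

EventuallyPositive : Poly1 → Set
EventuallyPositive h = ∃ λ (T : ℕ) → (t : ℕ) → T Data.Nat.≤ t → + 0 < evalP h t
  where import Data.Nat

module Submission where

-- Write aᵢ = αᵢ t + βᵢ, A = a₁, B = aₙ and
--   D = βₙα₁ − β₁αₙ > 0,   λᵢ = βₙαᵢ − βᵢαₙ ≥ 0,   μᵢ = βᵢα₁ − β₁αᵢ ≥ 0.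
-- The cross-multiplication identity  D·aᵢ = λᵢ·A + μᵢ·B  holds for every t,
-- so D·aᵢ ∈ ⟨A, B⟩.  Dividing each coefficient pᵢ of x = Σ pᵢaᵢ by D
-- therefore writes x = Σ rᵢaᵢ + (element of ⟨A, B⟩) with 0 ≤ rᵢ < D, and
-- conversely every such sum lies in ⟨a₁,…,aₙ⟩.  Hence H can be taken to be
-- the finite list of polynomials Σ rᵢ·(αᵢt + βᵢ) with all rᵢ < D; it
-- contains 0, and every non-zero member has positive leading coefficient or
-- is a positive constant, so it is eventually positive.

open import Defs
open import Data.Nat using (ℕ; suc)
open import Data.Integer using (ℤ; +_; _+_; _*_; _<_; _≤_)
open import Data.Fin using (Fin; zero; fromℕ)
open import Data.Product using (Σ; ∃; _×_; _,_)
open import Data.Sum using (_⊎_)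
open import Data.List using (List)
open import Data.List.Membership.Propositional using (_∈_)
open import Relation.Binary.PropositionalEquality using (_≡_)
open import Relation.Nullary using (¬_)
open import Data.Vec.Functional using ([]; _∷_)
import Data.Fin

open import Data.Fin using (toℕ; fromℕ<) renaming (suc to fsuc)
import Data.Fin.Properties as FinP
import Data.Nat as Nat
open import Data.Nat using (NonZero)
import Data.Nat.Properties as ℕP
open import Data.Nat.DivMod using (_%_; _/_; m≡m%n+[m/n]*n; m%n<n)
open import Data.Integer using (+[1+_]; -[1+_]; _-_; -_; ∣_∣; +<+)
import Data.Integer.Properties as ℤP
open import Data.Integer.Tactic.RingSolver using (solve-∀)
open import Data.List using ([_]; concatMap; map; allFin)
open import Data.List.Membership.Propositional using (lose)
open import Data.List.Membership.Propositional.Properties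
  using (∈-map⁺; ∈-map⁻; ∈-concatMap⁺; ∈-concatMap⁻; ∈-allFin)
open import Data.List.Relation.Unary.Any using (here; satisfied)
open import Data.Product using (proj₁; proj₂)
open import Data.Sum using (inj₁; inj₂)
open import Data.Empty using (⊥-elim)
open import Relation.Binary.PropositionalEquality
  using (refl; sym; trans; cong; cong₂; subst; module ≡-Reasoning)

sum-cong : ∀ n {f g : Fin n → ℤ} → (∀ i → f i ≡ g i) → sumFin n f ≡ sumFin n g
sum-cong Nat.zero    e = refl
sum-cong (Nat.suc n) e = cong₂ _+_ (e zero) (sum-cong n (λ i → e (fsuc i)))

sum-+ : ∀ n (f g : Fin n → ℤ) → sumFin n (λ i → f i + g i) ≡ sumFin n f + sumFin n g
sum-+ Nat.zero    f g = refl
sum-+ (Nat.suc n) f g =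
  trans (cong (λ z → (f zero + g zero) + z) (sum-+ n (λ i → f (fsuc i)) (λ i → g (fsuc i))))
        (interchange (f zero) (g zero) _ _)
  where
  interchange : ∀ a b c d → (a + b) + (c + d) ≡ (a + c) + (b + d)
  interchange = solve-∀

sumℕ : (n : ℕ) → (Fin n → ℕ) → ℕ
sumℕ Nat.zero    f = 0
sumℕ (Nat.suc n) f = f zero Nat.+ sumℕ n (λ i → f (fsuc i))

sum-linear : ∀ n (f : Fin n → ℤ) (u v : Fin n → ℕ) (A B : ℤ) →
  sumFin n (λ i → f i + (+ u i * A + + v i * B))
    ≡ sumFin n f + (+ sumℕ n u * A + + sumℕ n v * B)
sum-linear Nat.zero    f u v A B = refl
sum-linear (Nat.suc n) f u v A B = begin
  (f zero + (+ u zero * A + + v zero * B)) + sumFin n (λ i → f (fsuc i) + (+ u (fsuc i) * A + + v (fsuc i) * B))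
    ≡⟨ cong (λ z → (f zero + (+ u zero * A + + v zero * B)) + z) (sum-linear n (λ i → f (fsuc i)) (λ i → u (fsuc i)) (λ i → v (fsuc i)) A B) ⟩
  (f zero + (+ u zero * A + + v zero * B)) + (F + (+ U * A + + V * B))
    ≡⟨ rearrange (f zero) F (+ u zero) (+ U) (+ v zero) (+ V) A B ⟩
  (f zero + F) + ((+ u zero + + U) * A + (+ v zero + + V) * B)
    ≡⟨ cong₂ (λ p q → (f zero + F) + (p * A + q * B)) (sym (ℤP.pos-+ (u zero) U)) (sym (ℤP.pos-+ (v zero) V)) ⟩
  (f zero + F) + (+ (u zero Nat.+ U) * A + + (v zero Nat.+ V) * B) ∎
  where
  open ≡-Reasoning
  F : ℤ
  F = sumFin n (λ i → f (fsuc i))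
  U V : ℕ
  U = sumℕ n (λ i → u (fsuc i))
  V = sumℕ n (λ i → v (fsuc i))
  rearrange : ∀ f F u U v V A B →
    (f + (u * A + v * B)) + (F + (U * A + V * B)) ≡ (f + F) + ((u + U) * A + (v + V) * B)
  rearrange = solve-∀

unitAt : ∀ {n} → Fin n → ℕ → Fin n → ℕ
unitAt zero     u zero     = u
unitAt zero     u (fsuc _) = 0
unitAt (fsuc _) u zero     = 0
unitAt (fsuc k) u (fsuc i) = unitAt k u i

sum-unitAt : ∀ n (k : Fin n) (a : Fin n → ℤ) u → sumFin n (λ i → + unitAt k u i * a i) ≡ + u * a k
sum-unitAt (Nat.suc n) zero     a u = trans (cong (λ z → + u * a zero + z) (sum-zero n)) (ℤP.+-identityʳ _)
  where
  sum-zero : ∀ n → sumFin n (λ _ → + 0) ≡ + 0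
  sum-zero Nat.zero    = refl
  sum-zero (Nat.suc n) = trans (ℤP.+-identityˡ _) (sum-zero n)
sum-unitAt (Nat.suc n) (fsuc k) a u = trans (ℤP.+-identityˡ _) (sum-unitAt n k (λ i → a (fsuc i)) u)

-- Reduction of ⟨a₁,…,aₙ⟩ to shifts of a two-generator semigroup ⟨a_k, a_l⟩

InSG-add : ∀ n (a : Fin n → ℤ) {x} → InSG n a x → ∀ k u → InSG n a (x + + u * a k)
InSG-add n a {x} (p , x≡) k u = (λ i → p i Nat.+ unitAt k u i) , (begin
  x + + u * a k
    ≡⟨ cong₂ _+_ x≡ (sym (sum-unitAt n k a u)) ⟩
  sumFin n (λ i → + p i * a i) + sumFin n (λ i → + unitAt k u i * a i)
    ≡⟨ sym (sum-+ n _ _) ⟩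
  sumFin n (λ i → + p i * a i + + unitAt k u i * a i)
    ≡⟨ sum-cong n (λ i → trans (sym (ℤP.*-distribʳ-+ (a i) (+ p i) (+ unitAt k u i))) (cong (_* a i) (sym (ℤP.pos-+ (p i) _)))) ⟩
  sumFin n (λ i → + (p i Nat.+ unitAt k u i) * a i) ∎)
  where open ≡-Reasoning

shift⊆InSG : ∀ n (a : Fin n → ℤ) (r : Fin n → ℕ) (k l : Fin n) x →
  InShift (sumFin n (λ i → + r i * a i)) 2 (a k ∷ a l ∷ []) x → InSG n a x
shift⊆InSG n a r k l x (y , (uv , y≡) , x≡) =
  subst (InSG n a) (sym x≡combination) (InSG-add n a (InSG-add n a (r , refl) k u) l v)
  where
  open ≡-Reasoning
  u v : ℕ
  u = uv zero
  v = uv (fsuc zero)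
  S : ℤ
  S = sumFin n (λ i → + r i * a i)
  reassociate : ∀ S P Q → S + (P + (Q + + 0)) ≡ (S + P) + Q
  reassociate = solve-∀
  x≡combination : x ≡ (S + + u * a k) + + v * a l
  x≡combination = trans x≡ (trans (cong (λ z → S + z) y≡) (reassociate S _ _))

divide-coefficient : ∀ (D : ℕ) .{{_ : NonZero D}} (a A B : ℤ) (lam mu : ℕ) →
  + D * a ≡ + lam * A + + mu * B → (p : ℕ) →
  + p * a ≡ + (p % D) * a + (+ (p / D Nat.* lam) * A + + (p / D Nat.* mu) * B)
divide-coefficient D a A B lam mu split p = begin
  + p * a
    ≡⟨ cong (λ z → + z * a) (m≡m%n+[m/n]*n p D) ⟩
  + (r Nat.+ q Nat.* D) * a
    ≡⟨ cong (_* a) (trans (ℤP.pos-+ r (q Nat.* D)) (cong (λ z → + r + z) (ℤP.pos-* q D))) ⟩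
  (+ r + + q * + D) * a
    ≡⟨ distribute (+ r) (+ q) (+ D) a ⟩
  + r * a + + q * (+ D * a)
    ≡⟨ cong (λ z → + r * a + + q * z) split ⟩
  + r * a + + q * (+ lam * A + + mu * B)
    ≡⟨ distribute′ (+ r * a) (+ q) (+ lam) A (+ mu) B ⟩
  + r * a + ((+ q * + lam) * A + (+ q * + mu) * B)
    ≡⟨ cong₂ (λ c d → + r * a + (c * A + d * B)) (sym (ℤP.pos-* q lam)) (sym (ℤP.pos-* q mu)) ⟩
  + r * a + (+ (q Nat.* lam) * A + + (q Nat.* mu) * B) ∎
  where
  open ≡-Reasoning
  r q : ℕ
  r = p % D
  q = p / D
  distribute : ∀ r q D a → (r + q * D) * a ≡ r * a + q * (D * a)
  distribute = solve-∀
  distribute′ : ∀ s q L A M B → s + q * (L * A + M * B) ≡ s + ((q * L) * A + (q * M) * B)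
  distribute′ = solve-∀

InSG⇒reduced-shift : ∀ n (a : Fin n → ℤ) (A B : ℤ) (D : ℕ) .{{_ : NonZero D}} (lam mu : Fin n → ℕ) →
  (∀ i → + D * a i ≡ + lam i * A + + mu i * B) → ∀ x → InSG n a x →
  Σ (Fin n → ℕ) λ r → (∀ i → r i Nat.< D) × InShift (sumFin n (λ i → + r i * a i)) 2 (A ∷ B ∷ []) x
InSG⇒reduced-shift n a A B D lam mu split x (p , x≡) =
  r , (λ i → m%n<n (p i) D) , _ , (U ∷ V ∷ [] , refl) , x≡shift
  where
  open ≡-Reasoning
  r u v : Fin n → ℕ
  r i = p i % D
  u i = p i / D Nat.* lam i
  v i = p i / D Nat.* mu i
  U V : ℕ
  U = sumℕ n u
  V = sumℕ n v
  x≡shift : x ≡ sumFin n (λ i → + r i * a i) + (+ U * A + (+ V * B + + 0))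
  x≡shift = begin
    x
      ≡⟨ x≡ ⟩
    sumFin n (λ i → + p i * a i)
      ≡⟨ sum-cong n (λ i → divide-coefficient D (a i) A B (lam i) (mu i) (split i) (p i)) ⟩
    sumFin n (λ i → + r i * a i + (+ u i * A + + v i * B))
      ≡⟨ sum-linear n _ u v A B ⟩
    sumFin n (λ i → + r i * a i) + (+ U * A + + V * B)
      ≡⟨ cong (λ z → sumFin n (λ i → + r i * a i) + (+ U * A + z)) (sym (ℤP.+-identityʳ (+ V * B))) ⟩
    sumFin n (λ i → + r i * a i) + (+ U * A + (+ V * B + + 0)) ∎

scale : ℕ → Poly1 → Poly1
scale r (c , d) = (+ r * c , + r * d)

addP : Poly1 → Poly1 → Poly1
addP (c , d) (c′ , d′) = (c + c′ , d + d′)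

combination : (n : ℕ) → (Fin n → ℕ) → (Fin n → Poly1) → Poly1
combination Nat.zero    r g = (+ 0 , + 0)
combination (Nat.suc n) r g = addP (scale (r zero) (g zero)) (combination n (λ i → r (fsuc i)) (λ i → g (fsuc i)))

eval-combination : ∀ n r g t → evalP (combination n r g) t ≡ sumFin n (λ i → + r i * evalP (g i) t)
eval-combination Nat.zero    r g t = refl
eval-combination (Nat.suc n) r g t =
  trans (eval-step (+ r zero) (proj₁ (g zero)) (proj₂ (g zero)) (proj₁ S) (proj₂ S) (+ t))
        (cong (λ z → + r zero * evalP (g zero) t + z) (eval-combination n (λ i → r (fsuc i)) (λ i → g (fsuc i)) t))
  where
  S : Poly1
  S = combination n (λ i → r (fsuc i)) (λ i → g (fsuc i))
  eval-step : ∀ r c d c′ d′ t → (r * c + c′) * t + (r * d + d′) ≡ r * (c * t + d) + (c′ * t + d′)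
  eval-step = solve-∀

boundedCombinations : ℕ → (n : ℕ) → (Fin n → Poly1) → List Poly1
boundedCombinations D Nat.zero    g = [ (+ 0 , + 0) ]
boundedCombinations D (Nat.suc n) g =
  concatMap (λ k → map (addP (scale (toℕ k) (g zero))) (boundedCombinations D n (λ i → g (fsuc i))))
            (allFin D)

bounded-complete : ∀ D n g (r : Fin n → ℕ) → (∀ i → r i Nat.< D) → combination n r g ∈ boundedCombinations D n g
bounded-complete D Nat.zero    g r r<D = here refl
bounded-complete D (Nat.suc n) g r r<D =
  ∈-concatMap⁺ row {xs = allFin D} (lose (∈-allFin k) (subst (λ j → addP (scale j (g zero)) S ∈ row k) (FinP.toℕ-fromℕ< (r<D zero))
    (∈-map⁺ _ (bounded-complete D n (λ i → g (fsuc i)) (λ i → r (fsuc i)) (λ i → r<D (fsuc i))))))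
  where
  k : Fin D
  k = fromℕ< (r<D zero)
  S : Poly1
  S = combination n (λ i → r (fsuc i)) (λ i → g (fsuc i))
  row : Fin D → List Poly1
  row j = map (addP (scale (toℕ j) (g zero))) (boundedCombinations D n (λ i → g (fsuc i)))

bounded-sound : ∀ D n g h → h ∈ boundedCombinations D n g → Σ (Fin n → ℕ) λ r → h ≡ combination n r g
bounded-sound D Nat.zero    g h (here refl) = [] , refl
bounded-sound D (Nat.suc n) g h h∈ with satisfied (∈-concatMap⁻ _ {xs = allFin D} h∈)
... | k , h∈row with ∈-map⁻ _ h∈row
... | h′ , h′∈ , refl with bounded-sound D n (λ i → g (fsuc i)) h′ h′∈
... | r , refl = (toℕ k ∷ r) , refl

zero∈bounded : ∀ d n g → (+ 0 , + 0) ∈ boundedCombinations (suc d) n g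
zero∈bounded d n g = subst (_∈ boundedCombinations (suc d) n g) (combination-zero n g)
                       (bounded-complete (suc d) n g (λ _ → 0) (λ _ → Nat.s≤s Nat.z≤n))
  where
  combination-zero : ∀ n g → combination n (λ _ → 0) g ≡ (+ 0 , + 0)
  combination-zero Nat.zero    g = refl
  combination-zero (Nat.suc n) g rewrite combination-zero n (λ i → g (fsuc i)) = refl

-- Positivity of the shifts

LexPositive : Poly1 → Set
LexPositive (c , d) = (+ 0 < c) ⊎ (c ≡ + 0 × + 0 < d)

-- Zero or LexPositive; closed under non-negative integer combinations.
LexNonneg : Poly1 → Set
LexNonneg h = (h ≡ (+ 0 , + 0)) ⊎ LexPositive h

scale-nonneg : ∀ r h → LexPositive h → LexNonneg (scale r h)
scale-nonneg Nat.zero    h                _                  = inj₁ refl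
scale-nonneg (Nat.suc r) (+[1+ c ] , d)   (inj₁ _)           = inj₂ (inj₁ (+<+ (Nat.s≤s Nat.z≤n)))
scale-nonneg (Nat.suc r) (+ 0 , +[1+ d ]) (inj₂ (refl , _))  = inj₂ (inj₂ (ℤP.*-zeroʳ (+ suc r) , +<+ (Nat.s≤s Nat.z≤n)))
scale-nonneg (Nat.suc r) (+ 0 , d)        (inj₁ (+<+ ()))
scale-nonneg (Nat.suc r) (+ 0 , + 0)      (inj₂ (_ , +<+ ()))
scale-nonneg (Nat.suc r) (+ 0 , -[1+ d ]) (inj₂ (_ , ()))
scale-nonneg (Nat.suc r) (-[1+ c ] , d)   (inj₁ ())
scale-nonneg (Nat.suc r) (-[1+ c ] , d)   (inj₂ (() , _))

lead-nonneg : ∀ h → LexPositive h → + 0 ≤ proj₁ h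
lead-nonneg h (inj₁ 0<c)       = ℤP.<⇒≤ 0<c
lead-nonneg h (inj₂ (refl , _)) = ℤP.≤-refl

add-nonneg : ∀ h k → LexNonneg h → LexNonneg k → LexNonneg (addP h k)
add-nonneg (c , d) k (inj₁ refl) q = subst LexNonneg (sym (cong₂ _,_ (ℤP.+-identityˡ _) (ℤP.+-identityˡ _))) q
add-nonneg h (c , d) (inj₂ p) (inj₁ refl) = inj₂ (subst LexPositive (sym (cong₂ _,_ (ℤP.+-identityʳ _) (ℤP.+-identityʳ _))) p)
add-nonneg h k (inj₂ (inj₁ 0<c)) (inj₂ q) = inj₂ (inj₁ (ℤP.+-mono-<-≤ 0<c (lead-nonneg k q)))
add-nonneg h (c′ , d′) (inj₂ (inj₂ (refl , _))) (inj₂ (inj₁ 0<c′)) =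
  inj₂ (inj₁ (subst (+ 0 <_) (sym (ℤP.+-identityˡ c′)) 0<c′))
add-nonneg h (c′ , d′) (inj₂ (inj₂ (refl , 0<d))) (inj₂ (inj₂ (refl , 0<d′))) =
  inj₂ (inj₂ (refl , ℤP.+-mono-<-≤ 0<d (ℤP.<⇒≤ 0<d′)))

combination-nonneg : ∀ n r g → (∀ i → LexPositive (g i)) → LexNonneg (combination n r g)
combination-nonneg Nat.zero    r g pos = inj₁ refl
combination-nonneg (Nat.suc n) r g pos =
  add-nonneg _ _ (scale-nonneg (r zero) (g zero) (pos zero)) (combination-nonneg n _ _ (λ i → pos (fsuc i)))

-- c·t + d with c ≥ 1: c·t − (d'+1) > 0 once t ≥ d' + 2.
lexPositive⇒eventuallyPositive : ∀ h → LexPositive h → EventuallyPositive h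
lexPositive⇒eventuallyPositive (c , d) (inj₂ (refl , 0<d)) =
  0 , λ t _ → subst (+ 0 <_) (sym (ℤP.+-identityˡ d)) 0<d
lexPositive⇒eventuallyPositive (+[1+ c ] , + d) (inj₁ _) = 1 , λ { (Nat.suc t) _ → +<+ (Nat.s≤s Nat.z≤n) }
lexPositive⇒eventuallyPositive (+[1+ c ] , -[1+ d ]) (inj₁ _) = suc (suc d) , λ t d+2≤t →
  let d<ct : suc d Nat.< suc c Nat.* t
      d<ct = ℕP.≤-trans d+2≤t (ℕP.m≤n*m t (suc c))
  in subst (+ 0 <_) (sym (trans (cong (_+ -[1+ d ]) (sym (ℤP.pos-* (suc c) t))) (ℤP.⊖-≥ (ℕP.<⇒≤ d<ct))))
       (+<+ (ℕP.m<n⇒0<n∸m d<ct))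
lexPositive⇒eventuallyPositive (+ 0 , d) (inj₁ (+<+ ()))
lexPositive⇒eventuallyPositive (-[1+ c ] , d) (inj₁ ())

bounded-eventuallyPositive : ∀ D n g → (∀ i → LexPositive (g i)) →
  (h : Poly1) → h ∈ boundedCombinations D n g → ¬ (h ≡ (+ 0 , + 0)) → EventuallyPositive h
bounded-eventuallyPositive D n g pos h h∈ h≢0 with bounded-sound D n g h h∈
... | r , refl with combination-nonneg n r g pos
... | inj₁ h≡0 = ⊥-elim (h≢0 h≡0)
... | inj₂ p   = lexPositive⇒eventuallyPositive _ p

-- The cross-multiplication identity

-- (β_l α_k − β_k α_l)·aᵢ = (β_l αᵢ − βᵢ α_l)·a_k + (βᵢ α_k − β_k αᵢ)·a_l,
-- with all three coefficients non-negative under the ordering hypotheses.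
cross-decomposition : ∀ n (α β : Fin n → ℤ) (k l : Fin n) →
  (∀ i → β k * α i ≤ β i * α k) → (∀ i → β i * α l ≤ β l * α i) → β k * α l < β l * α k →
  Σ ℕ λ d → Σ (Fin n → ℕ) λ lam → Σ (Fin n → ℕ) λ mu → ∀ t i →
    + suc d * evalP (α i , β i) t ≡ + lam i * evalP (α k , β k) t + + mu i * evalP (α l , β l) t
cross-decomposition n α β k l k-min l-max k<l = d , lam , mu , split
  where
  open ≡-Reasoning
  difference-pos : ∀ {i j} → i < j → + 0 < j - i
  difference-pos {i} {j} i<j = subst (_< j - i) (ℤP.+-inverseʳ i) (ℤP.+-monoˡ-< (- i) i<j)
  positive⇒suc : ∀ z → + 0 < z → Σ ℕ λ d → z ≡ + suc d
  positive⇒suc +[1+ d ] _ = d , refl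
  positive⇒suc (+ 0)    (+<+ ())
  positive⇒suc -[1+ _ ] ()
  D≡suc : Σ ℕ λ d → β l * α k - β k * α l ≡ + suc d
  D≡suc = positive⇒suc _ (difference-pos k<l)
  d : ℕ
  d = proj₁ D≡suc
  lam mu : Fin n → ℕ
  lam i = ∣ β l * α i - β i * α l ∣
  mu i  = ∣ β i * α k - β k * α i ∣
  identity : ∀ ak bk ai bi al bl t →
    (bl * ak - bk * al) * (ai * t + bi) ≡ (bl * ai - bi * al) * (ak * t + bk) + (bi * ak - bk * ai) * (al * t + bl)
  identity = solve-∀
  split : ∀ t i → + suc d * evalP (α i , β i) t ≡ + lam i * evalP (α k , β k) t + + mu i * evalP (α l , β l) t
  split t i = begin
    + suc d * evalP (α i , β i) t
      ≡⟨ cong (_* evalP (α i , β i) t) (sym (proj₂ D≡suc)) ⟩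
    (β l * α k - β k * α l) * evalP (α i , β i) t
      ≡⟨ identity (α k) (β k) (α i) (β i) (α l) (β l) (+ t) ⟩
    (β l * α i - β i * α l) * evalP (α k , β k) t + (β i * α k - β k * α i) * evalP (α l , β l) t
      ≡⟨ sym (cong₂ (λ p q → p * evalP (α k , β k) t + q * evalP (α l , β l) t)
                    (ℤP.0≤i⇒+∣i∣≡i (ℤP.i≤j⇒0≤j-i (l-max i))) (ℤP.0≤i⇒+∣i∣≡i (ℤP.i≤j⇒0≤j-i (k-min i)))) ⟩
    + lam i * evalP (α k , β k) t + + mu i * evalP (α l , β l) t ∎

InShifts : List Poly1 → ℕ → ℤ → ℤ → ℤ → Set
InShifts H t A B x = Σ Poly1 λ h → h ∈ H × InShift (evalP h t) 2 (A ∷ B ∷ []) x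

shift-decomposition : ∀ n (g : Fin n → Poly1) (k l : Fin n) (d : ℕ) (lam mu : Fin n → ℕ) →
  (∀ t i → + suc d * evalP (g i) t ≡ + lam i * evalP (g k) t + + mu i * evalP (g l) t) →
  ∀ t x →
    (InSG n (λ i → evalP (g i) t) x → InShifts (boundedCombinations (suc d) n g) t (evalP (g k) t) (evalP (g l) t) x)
    × (InShifts (boundedCombinations (suc d) n g) t (evalP (g k) t) (evalP (g l) t) x → InSG n (λ i → evalP (g i) t) x)
shift-decomposition n g k l d lam mu split t x = cover , covered
  where
  a : Fin n → ℤ
  a i = evalP (g i) t
  H : List Poly1
  H = boundedCombinations (suc d) n g
  cover : InSG n a x → InShifts H t (a k) (a l) x
  cover x∈ with InSG⇒reduced-shift n a (a k) (a l) (suc d) lam mu (split t) x x∈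
  ... | r , r<D , shift = combination n r g , bounded-complete (suc d) n g r r<D ,
                          subst (λ c → InShift c 2 (a k ∷ a l ∷ []) x) (sym (eval-combination n r g t)) shift
  covered : InShifts H t (a k) (a l) x → InSG n a x
  covered (h , h∈ , shift) with bounded-sound (suc d) n g h h∈
  ... | r , refl = shift⊆InSG n a r k l x (subst (λ c → InShift c 2 (a k ∷ a l ∷ []) x) (eval-combination n r g t) shift)

lemma6 : (m : ℕ) → (α β : Fin (suc (suc m)) → ℤ)
    → ((i : Fin (suc (suc m))) → (+ 0 < α i) ⊎ (α i ≡ + 0 × + 0 < β i))
    → ((i j : Fin (suc (suc m))) → i Data.Fin.≤ j → β i * α j ≤ β j * α i)
    → β zero * α (fromℕ (suc m)) < β (fromℕ (suc m)) * α zero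
    → Σ (List Poly1) λ H →
        ((+ 0 , + 0) ∈ H)
        × ((h : Poly1) → h ∈ H → ¬ (h ≡ (+ 0 , + 0)) → EventuallyPositive h)
        × ((t : ℕ) → 1 Data.Nat.≤ t
           → ((i : Fin (suc (suc m))) → + 0 < α i * (+ t) + β i)
           → (x : ℤ)
           → (InSG (suc (suc m)) (λ i → α i * (+ t) + β i) x
              → Σ Poly1 λ h → h ∈ H
                  × InShift (evalP h t) 2
                      ((α zero * (+ t) + β zero) ∷ (α (fromℕ (suc m)) * (+ t) + β (fromℕ (suc m))) ∷ []) x)
           × ((Σ Poly1 λ h → h ∈ H
                  × InShift (evalP h t) 2
                      ((α zero * (+ t) + β zero) ∷ (α (fromℕ (suc m)) * (+ t) + β (fromℕ (suc m))) ∷ []) x)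
              → InSG (suc (suc m)) (λ i → α i * (+ t) + β i) x))
lemma6 m α β shape ordered strict
  with cross-decomposition (suc (suc m)) α β zero (fromℕ (suc m))
         (λ i → ordered zero i Nat.z≤n) (λ i → ordered i (fromℕ (suc m)) (FinP.≤fromℕ i)) strict
... | d , lam , mu , split =
  boundedCombinations (suc d) (suc (suc m)) g ,
  zero∈bounded d (suc (suc m)) g ,
  bounded-eventuallyPositive (suc d) (suc (suc m)) g shape ,
  λ t _ _ → shift-decomposition (suc (suc m)) g zero (fromℕ (suc m)) d lam mu split t
  where
  g : Fin (suc (suc m)) → Poly1
  g i = (α i , β i)
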